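{- Let $n>r\ge 1$ be integers. Then for every pair of adjacent bases $B_1,B_2$ of $\operatorname{BG}(U_{r,n})$, there are at least $3(n-r-1)(r-1)$ distinct good cycles for $B_1B_2$.
   Context: The uniform matroid $U_{r,n}$ has ground set $[n]=\{1,\dots,n\}$, and its bases are all $r$-subsets of $[n]$. For a matroid $M$, its basis graph $\operatorname{BG}(M)$ has the bases of $M$ as vertices, two bases $B,B'$ being adjacent if and only if $|B\triangle B'|=2$. For adjacent bases $B_1,B_2$ with $B_1\setminus B_2=\{e\}$, a good cycle for $B_1B_2$ is a sequence of four distinct bases $B_1B_2B_3B_4$ forming a cycle in $\operatorname{BG}(M)$ (so that $B_2B_3$, $B_3B_4$ and $B_4B_1$ are edges) such that $e\in B_4$ and $e\notin B_3$. -}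

module Defs where

open import Data.Nat using (ℕ)
open import Data.Fin using (Fin)
open import Data.Fin.Subset using (Subset; _∈_; _∉_; _∪_; _─_; ∣_∣)
open import Data.Product using (_×_)
open import Relation.Binary.PropositionalEquality using (_≡_; _≢_)

IsBasisU : (r n : ℕ) → Subset n → Set
IsBasisU r n B = ∣ B ∣ ≡ r

_△_ : ∀ {n} → Subset n → Subset n → Subset n
B △ B' = (B ─ B') ∪ (B' ─ B)

AdjU : (r n : ℕ) → Subset n → Subset n → Set
AdjU r n B B' = IsBasisU r n B × IsBasisU r n B' × ∣ B △ B' ∣ ≡ 2

Distinct4 : ∀ {n} → Subset n → Subset n → Subset n → Subset n → Set
Distinct4 B₁ B₂ B₃ B₄ =
  B₁ ≢ B₂ × B₁ ≢ B₃ × B₁ ≢ B₄ × B₂ ≢ B₃ × B₂ ≢ B₄ × B₃ ≢ B₄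

-- B₁B₂B₃B₄ is a good cycle for the edge B₁B₂ of BG(U_{r,n}):
-- four distinct bases, B₂B₃, B₃B₄, B₄B₁ edges, and for the element e
-- with B₁ ∖ B₂ = {e} we have e ∈ B₄, e ∉ B₃.
-- (When B₁B₂ is an edge, B₁ ∖ B₂ is a singleton, so quantifying over
-- its elements pins down e.)
GoodCycleU : (r n : ℕ) → Subset n → Subset n → Subset n → Subset n → Set
GoodCycleU r n B₁ B₂ B₃ B₄ =
  Distinct4 B₁ B₂ B₃ B₄ ×
  AdjU r n B₂ B₃ × AdjU r n B₃ B₄ × AdjU r n B₄ B₁ ×
  (∀ (e : Fin n) → e ∈ B₁ → e ∉ B₂ → e ∈ B₄ × e ∉ B₃)

-- Write B₁ = B₂ − f + e. For every a ∈ B₁ ∩ B₂ (r − 1 choices) and every y outside B₁ ∪ B₂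
-- (n − r − 1 choices) there are three good cycles B₁B₂B₃B₄:
--   B₃ = B₂ − f + y, B₄ = B₁ − a + y;
--   B₃ = B₂ − a + y, B₄ = B₁ − a + y;
--   B₃ = B₂ − a + y, B₄ = B₁ − a + f.
-- Each step is an exchange S ↦ S − x + z with x ∈ S, z ∉ S, hence an edge of the basis graph. The
-- three shapes are told apart by whether f lies in B₃ and in B₄; within a shape, a is the only
-- element of B₁ ∩ B₂ missing from B₄ and y the only element outside B₁ ∪ B₂ lying in B₃.
-- Subsets are handled through single-element toggles S ⊕ p, so that S − x + z is S ⊕ x ⊕ z.
module Submission where

open import Defs
open import Data.Bool using (Bool; true; false; not)
open import Data.Bool.Properties using (not-involutive; not-injective)
open import Data.Fin using (Fin; zero; suc; _≟_)
open import Data.Fin.Subset using (Subset; _∈_; _∉_; _∩_; _─_; ∣_∣; ⊥; ∁)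
open import Data.Fin.Subset.Properties using (∣⊥∣≡0; ∪-comm; ∩-comm; ∣∁p∣≡n∸∣p∣)
open import Data.Nat using (ℕ; zero; suc; pred; _+_; _*_; _∸_; _≤_; _<_)
open import Data.Nat.Properties using (+-suc; +-cancelˡ-≡; suc-injective; m+1+n≢0; *-assoc; ≤-reflexive)
open import Data.Product using (Σ; ∃₂; _×_; _,_; proj₁; proj₂)
open import Data.Vec using ([]; _∷_; lookup; updateAt; tabulate)
open import Data.Vec.Properties
  using ( lookup∘updateAt; lookup∘updateAt′; updateAt-updateAt; updateAt-cong; updateAt-id
        ; updateAt-commutes; lookup-replicate; lookup-map; tabulate∘lookup; tabulate-cong
        ; []=⇒lookup; lookup⇒[]=)
open import Data.List as List using (List; []; _∷_; length; _++_; cartesianProduct; allFin)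
open import Data.List.Properties using (length-map; length-++)
open import Data.List.Membership.Propositional using () renaming (_∈_ to _∈ₗ_)
open import Data.List.Membership.Propositional.Properties using (∈-map⁻; ∈-cartesianProduct⁻)
open import Data.List.Relation.Unary.All as All using (All; []; _∷_)
import Data.List.Relation.Unary.All.Properties as All
open import Data.List.Relation.Unary.Any using (here; there)
open import Data.List.Relation.Unary.AllPairs using ([]; _∷_)
open import Data.List.Relation.Unary.Unique.Propositional using (Unique)
import Data.List.Relation.Unary.Unique.Propositional.Properties as Unique
import Data.Fin.Properties as Fin
open import Function using (_∘_)
open import Relation.Binary.PropositionalEquality
open import Relation.Nullary using (yes; no; contradiction)
open import Relation.Nullary.Decidable using (decidable-stable)

private
  variable
    n r : ℕ

infixl 6 _⊕_

_⊕_ : Subset n → Fin n → Subset n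
S ⊕ p = updateAt S p not

lookup-⊕-self : ∀ (S : Subset n) p → lookup (S ⊕ p) p ≡ not (lookup S p)
lookup-⊕-self S p = lookup∘updateAt p S

lookup-⊕-other : ∀ (S : Subset n) {p i} → i ≢ p → lookup (S ⊕ p) i ≡ lookup S i
lookup-⊕-other S {p} {i} i≢p = lookup∘updateAt′ i p i≢p S

⊕-involutive : ∀ (S : Subset n) p → S ⊕ p ⊕ p ≡ S
⊕-involutive S p = begin
  S ⊕ p ⊕ p                   ≡⟨ updateAt-updateAt p S ⟩
  updateAt S p (not ∘ not)    ≡⟨ updateAt-cong p not-involutive S ⟩
  updateAt S p (λ b → b)      ≡⟨ updateAt-id p S ⟩
  S                           ∎
  where open ≡-Reasoning

⊕-comm : ∀ (S : Subset n) p q → S ⊕ p ⊕ q ≡ S ⊕ q ⊕ p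
⊕-comm S p q with p ≟ q
... | yes refl = refl
... | no p≢q   = updateAt-commutes q p (p≢q ∘ sym) S

lookup-⊕⊕-other : ∀ (S : Subset n) {x z i} → i ≢ x → i ≢ z → lookup (S ⊕ x ⊕ z) i ≡ lookup S i
lookup-⊕⊕-other S i≢x i≢z = trans (lookup-⊕-other (S ⊕ _) i≢z) (lookup-⊕-other S i≢x)

lookup-⊕⁻ : ∀ (S : Subset n) {p i} → lookup S p ≡ true → lookup (S ⊕ p) i ≡ true →
  i ≢ p × lookup S i ≡ true
lookup-⊕⁻ S {p} {i} Sp h with i ≟ p
... | yes refl = contradiction (trans (sym h) (trans (lookup-⊕-self S p) (cong not Sp))) λ ()
... | no i≢p   = i≢p , trans (sym (lookup-⊕-other S i≢p)) h

∣⊕∣-insert : ∀ (S : Subset n) p → lookup S p ≡ false → ∣ S ⊕ p ∣ ≡ suc ∣ S ∣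
∣⊕∣-insert (false ∷ S) zero    _ = refl
∣⊕∣-insert (true  ∷ S) (suc p) h = cong suc (∣⊕∣-insert S p h)
∣⊕∣-insert (false ∷ S) (suc p) h = ∣⊕∣-insert S p h

∣⊕∣-remove : ∀ (S : Subset n) p → lookup S p ≡ true → ∣ S ⊕ p ∣ ≡ ∣ S ∣ ∸ 1
∣⊕∣-remove S p Sp = begin
  ∣ S ⊕ p ∣              ≡⟨⟩
  suc ∣ S ⊕ p ∣ ∸ 1      ≡⟨ cong (_∸ 1) (∣⊕∣-insert (S ⊕ p) p (trans (lookup-⊕-self S p) (cong not Sp))) ⟨
  ∣ S ⊕ p ⊕ p ∣ ∸ 1      ≡⟨ cong (λ T → ∣ T ∣ ∸ 1) (⊕-involutive S p) ⟩
  ∣ S ∣ ∸ 1              ∎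
  where open ≡-Reasoning

△-⊕ : ∀ (S T : Subset n) p → S △ (T ⊕ p) ≡ (S △ T) ⊕ p
△-⊕ (true  ∷ S) (true  ∷ T) zero    = refl
△-⊕ (true  ∷ S) (false ∷ T) zero    = refl
△-⊕ (false ∷ S) (true  ∷ T) zero    = refl
△-⊕ (false ∷ S) (false ∷ T) zero    = refl
△-⊕ (b ∷ S)     (c ∷ T)     (suc p) = cong (_ ∷_) (△-⊕ S T p)

△-self : ∀ (S : Subset n) → S △ S ≡ ⊥
△-self []          = refl
△-self (true  ∷ S) = cong (false ∷_) (△-self S)
△-self (false ∷ S) = cong (false ∷_) (△-self S)

lookup-≢ : ∀ {S : Subset n} {i j} → lookup S i ≡ true → lookup S j ≡ false → i ≢ j
lookup-≢ Si Sj refl = contradiction (trans (sym Si) Sj) λ ()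

differ-at⇒≢ : ∀ {S T : Subset n} {i} → lookup S i ≡ true → lookup T i ≡ false → S ≢ T
differ-at⇒≢ Si Ti refl = contradiction (trans (sym Si) Ti) λ ()

∣⊥⊕⊕∣ : ∀ {x z : Fin n} → x ≢ z → ∣ ⊥ ⊕ x ⊕ z ∣ ≡ 2
∣⊥⊕⊕∣ {n} {x} {z} x≢z = begin
  ∣ ⊥ ⊕ x ⊕ z ∣    ≡⟨ ∣⊕∣-insert (⊥ ⊕ x) z (trans (lookup-⊕-other ⊥ (x≢z ∘ sym)) (lookup-⊥ z)) ⟩
  suc ∣ ⊥ ⊕ x ∣    ≡⟨ cong suc (∣⊕∣-insert ⊥ x (lookup-⊥ x)) ⟩
  2 + ∣ ⊥ {n} ∣    ≡⟨ cong (2 +_) (∣⊥∣≡0 n) ⟩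
  2                ∎
  where
  open ≡-Reasoning
  lookup-⊥ : ∀ i → lookup (⊥ {n}) i ≡ false
  lookup-⊥ i = lookup-replicate i false

exchange-adjacent : ∀ (S : Subset n) {x z} → ∣ S ∣ ≡ r → lookup S x ≡ true → lookup S z ≡ false →
  AdjU r n S (S ⊕ x ⊕ z)
exchange-adjacent S {x} {z} ∣S∣ Sx Sz = ∣S∣ , trans ∣S⊕x⊕z∣ ∣S∣ , trans (cong ∣_∣ S△S⊕x⊕z) (∣⊥⊕⊕∣ x≢z)
  where
  open ≡-Reasoning
  x≢z : x ≢ z
  x≢z = lookup-≢ {S = S} Sx Sz
  ∣S⊕x⊕z∣ : ∣ S ⊕ x ⊕ z ∣ ≡ ∣ S ∣
  ∣S⊕x⊕z∣ = begin
    ∣ S ⊕ x ⊕ z ∣    ≡⟨ ∣⊕∣-insert (S ⊕ x) z (trans (lookup-⊕-other S (x≢z ∘ sym)) Sz) ⟩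
    suc ∣ S ⊕ x ∣    ≡⟨ ∣⊕∣-insert (S ⊕ x) x (trans (lookup-⊕-self S x) (cong not Sx)) ⟨
    ∣ S ⊕ x ⊕ x ∣    ≡⟨ cong ∣_∣ (⊕-involutive S x) ⟩
    ∣ S ∣            ∎
  S△S⊕x⊕z : S △ (S ⊕ x ⊕ z) ≡ ⊥ ⊕ x ⊕ z
  S△S⊕x⊕z = begin
    S △ (S ⊕ x ⊕ z)    ≡⟨ △-⊕ S (S ⊕ x) z ⟩
    S △ (S ⊕ x) ⊕ z    ≡⟨ cong (_⊕ z) (△-⊕ S S x) ⟩
    S △ S ⊕ x ⊕ z      ≡⟨ cong (λ T → T ⊕ x ⊕ z) (△-self S) ⟩
    ⊥ ⊕ x ⊕ z          ∎

AdjU-sym : ∀ {S T : Subset n} → AdjU r n S T → AdjU r n T S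
AdjU-sym {S = S} {T} (∣S∣ , ∣T∣ , ∣S△T∣) = ∣T∣ , ∣S∣ , trans (cong ∣_∣ (∪-comm (T ─ S) (S ─ T))) ∣S△T∣

AdjU⇒≢ : ∀ {S T : Subset n} → AdjU r n S T → S ≢ T
AdjU⇒≢ {n = n} {S = S} (_ , _ , ∣S△S∣) refl =
  contradiction (trans (sym ∣S△S∣) (trans (cong ∣_∣ (△-self S)) (∣⊥∣≡0 n))) λ ()

good-cycle : ∀ {B₁ B₂ B₃ B₄ : Subset n} {e} →
  AdjU r n B₁ B₂ → AdjU r n B₂ B₃ → AdjU r n B₃ B₄ → AdjU r n B₄ B₁ →
  lookup B₁ e ≡ true → lookup B₂ e ≡ false → lookup B₃ e ≡ false → lookup B₄ e ≡ true →
  (∀ e′ → e′ ∈ B₁ → e′ ∉ B₂ → e′ ≡ e) →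
  GoodCycleU r n B₁ B₂ B₃ B₄
good-cycle {B₃ = B₃} {B₄} {e} a₁₂ a₂₃ a₃₄ a₄₁ B₁e B₂e B₃e B₄e e-unique =
  ( AdjU⇒≢ a₁₂ , differ-at⇒≢ B₁e B₃e , (AdjU⇒≢ a₄₁ ∘ sym)
  , AdjU⇒≢ a₂₃ , (differ-at⇒≢ B₄e B₂e ∘ sym) , AdjU⇒≢ a₃₄ )
  , a₂₃ , a₃₄ , a₄₁ , λ e′ e′∈B₁ e′∉B₂ → e′-good (e-unique e′ e′∈B₁ e′∉B₂)
  where
  e′-good : ∀ {e′} → e′ ≡ e → e′ ∈ B₄ × e′ ∉ B₃
  e′-good refl = lookup⇒[]= e B₄ B₄e , λ e∈B₃ → contradiction (trans (sym ([]=⇒lookup e∈B₃)) B₃e) λ ()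

∣p∣≡∣p∩q∣+∣p─q∣ : ∀ (p q : Subset n) → ∣ p ∣ ≡ ∣ p ∩ q ∣ + ∣ p ─ q ∣
∣p∣≡∣p∩q∣+∣p─q∣ []          []          = refl
∣p∣≡∣p∩q∣+∣p─q∣ (true  ∷ p) (true  ∷ q) = cong suc (∣p∣≡∣p∩q∣+∣p─q∣ p q)
∣p∣≡∣p∩q∣+∣p─q∣ (true  ∷ p) (false ∷ q) = trans (cong suc (∣p∣≡∣p∩q∣+∣p─q∣ p q)) (sym (+-suc _ _))
∣p∣≡∣p∩q∣+∣p─q∣ (false ∷ p) (true  ∷ q) = ∣p∣≡∣p∩q∣+∣p─q∣ p q
∣p∣≡∣p∩q∣+∣p─q∣ (false ∷ p) (false ∷ q) = ∣p∣≡∣p∩q∣+∣p─q∣ p q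

∣p△q∣≡∣p─q∣+∣q─p∣ : ∀ (p q : Subset n) → ∣ p △ q ∣ ≡ ∣ p ─ q ∣ + ∣ q ─ p ∣
∣p△q∣≡∣p─q∣+∣q─p∣ []          []          = refl
∣p△q∣≡∣p─q∣+∣q─p∣ (true  ∷ p) (true  ∷ q) = ∣p△q∣≡∣p─q∣+∣q─p∣ p q
∣p△q∣≡∣p─q∣+∣q─p∣ (true  ∷ p) (false ∷ q) = cong suc (∣p△q∣≡∣p─q∣+∣q─p∣ p q)
∣p△q∣≡∣p─q∣+∣q─p∣ (false ∷ p) (true  ∷ q) = trans (cong suc (∣p△q∣≡∣p─q∣+∣q─p∣ p q)) (sym (+-suc _ _))
∣p△q∣≡∣p─q∣+∣q─p∣ (false ∷ p) (false ∷ q) = ∣p△q∣≡∣p─q∣+∣q─p∣ p q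

∣p∣≡0⇒lookup≡false : ∀ (p : Subset n) → ∣ p ∣ ≡ 0 → ∀ i → lookup p i ≡ false
∣p∣≡0⇒lookup≡false (false ∷ p) ∣p∣≡0 zero    = refl
∣p∣≡0⇒lookup≡false (false ∷ p) ∣p∣≡0 (suc i) = ∣p∣≡0⇒lookup≡false p ∣p∣≡0 i

∣p∣≡1⇒singleton : ∀ (p : Subset n) → ∣ p ∣ ≡ 1 →
  Σ (Fin n) λ x → lookup p x ≡ true × ∀ y → lookup p y ≡ true → y ≡ x
∣p∣≡1⇒singleton (true  ∷ p) ∣p∣≡1 = zero , refl , only-zero
  where
  only-zero : ∀ y → lookup (true ∷ p) y ≡ true → y ≡ zero
  only-zero zero    _  = refl
  only-zero (suc y) py = contradiction (trans (sym py) (∣p∣≡0⇒lookup≡false p (cong pred ∣p∣≡1) y)) λ ()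
∣p∣≡1⇒singleton (false ∷ p) ∣p∣≡1 with ∣p∣≡1⇒singleton p ∣p∣≡1
... | x , px , unique = suc x , px , only-suc-x
  where
  only-suc-x : ∀ y → lookup (false ∷ p) y ≡ true → y ≡ suc x
  only-suc-x (suc y) py = cong suc (unique y py)

lookup-─⁺ : ∀ (p q : Subset n) {i} → lookup p i ≡ true → lookup q i ≡ false → lookup (p ─ q) i ≡ true
lookup-─⁺ (true ∷ p) (false ∷ q) {zero}  _  _  = refl
lookup-─⁺ (_    ∷ p) (_     ∷ q) {suc i} pi qi = lookup-─⁺ p q pi qi

lookup-─⁻ : ∀ (p q : Subset n) {i} → lookup (p ─ q) i ≡ true → lookup p i ≡ true × lookup q i ≡ false
lookup-─⁻ (true  ∷ p) (false ∷ q) {zero}  _ = refl , refl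
lookup-─⁻ (true  ∷ p) (true  ∷ q) {zero}  ()
lookup-─⁻ (false ∷ p) (true  ∷ q) {zero}  ()
lookup-─⁻ (false ∷ p) (false ∷ q) {zero}  ()
lookup-─⁻ (_     ∷ p) (_     ∷ q) {suc i} h = lookup-─⁻ p q h

m+m≡2⇒m≡1 : ∀ m → m + m ≡ 2 → m ≡ 1
m+m≡2⇒m≡1 1             _  = refl
m+m≡2⇒m≡1 (suc (suc m)) eq = contradiction (suc-injective (suc-injective eq)) (m+1+n≢0 m)

AdjU⇒∣─∣≡1 : ∀ {u v : Subset n} → AdjU r n u v → ∣ u ─ v ∣ ≡ 1
AdjU⇒∣─∣≡1 {u = u} {v} (∣u∣ , ∣v∣ , ∣u△v∣) = m+m≡2⇒m≡1 ∣ u ─ v ∣ (begin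
  ∣ u ─ v ∣ + ∣ u ─ v ∣    ≡⟨ cong (∣ u ─ v ∣ +_) ∣u─v∣≡∣v─u∣ ⟩
  ∣ u ─ v ∣ + ∣ v ─ u ∣    ≡⟨ ∣p△q∣≡∣p─q∣+∣q─p∣ u v ⟨
  ∣ u △ v ∣                ≡⟨ ∣u△v∣ ⟩
  2                        ∎)
  where
  open ≡-Reasoning
  ∣u─v∣≡∣v─u∣ : ∣ u ─ v ∣ ≡ ∣ v ─ u ∣
  ∣u─v∣≡∣v─u∣ = +-cancelˡ-≡ ∣ u ∩ v ∣ _ _ (begin
    ∣ u ∩ v ∣ + ∣ u ─ v ∣    ≡⟨ ∣p∣≡∣p∩q∣+∣p─q∣ u v ⟨
    ∣ u ∣                    ≡⟨ trans ∣u∣ (sym ∣v∣) ⟩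
    ∣ v ∣                    ≡⟨ ∣p∣≡∣p∩q∣+∣p─q∣ v u ⟩
    ∣ v ∩ u ∣ + ∣ v ─ u ∣    ≡⟨ cong (λ w → ∣ w ∣ + ∣ v ─ u ∣) (∩-comm v u) ⟩
    ∣ u ∩ v ∣ + ∣ v ─ u ∣    ∎)

differ-exactly-at⇒≡⊕⊕ : ∀ (u v : Subset n) {e f} →
  lookup (u ─ v) e ≡ true → (∀ i → lookup (u ─ v) i ≡ true → i ≡ e) →
  lookup (v ─ u) f ≡ true → (∀ i → lookup (v ─ u) i ≡ true → i ≡ f) →
  u ≡ v ⊕ e ⊕ f
differ-exactly-at⇒≡⊕⊕ u v {e} {f} u─v∋e e-unique v─u∋f f-unique = begin
  u                             ≡⟨ tabulate∘lookup u ⟨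
  tabulate (lookup u)           ≡⟨ tabulate-cong pointwise ⟩
  tabulate (lookup (v ⊕ e ⊕ f)) ≡⟨ tabulate∘lookup (v ⊕ e ⊕ f) ⟩
  v ⊕ e ⊕ f                     ∎
  where
  open ≡-Reasoning
  ue : lookup u e ≡ true
  ue = proj₁ (lookup-─⁻ u v u─v∋e)
  ve : lookup v e ≡ false
  ve = proj₂ (lookup-─⁻ u v u─v∋e)
  vf : lookup v f ≡ true
  vf = proj₁ (lookup-─⁻ v u v─u∋f)
  uf : lookup u f ≡ false
  uf = proj₂ (lookup-─⁻ v u v─u∋f)
  e≢f : e ≢ f
  e≢f = lookup-≢ {S = u} ue uf

  agree : ∀ {i} → i ≢ e → i ≢ f → lookup u i ≡ lookup v i
  agree {i} i≢e i≢f with lookup u i in ui | lookup v i in vi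
  ... | true  | true  = refl
  ... | false | false = refl
  ... | true  | false = contradiction (e-unique i (lookup-─⁺ u v ui vi)) i≢e
  ... | false | true  = contradiction (f-unique i (lookup-─⁺ v u vi ui)) i≢f

  pointwise : ∀ i → lookup u i ≡ lookup (v ⊕ e ⊕ f) i
  pointwise i with i ≟ e | i ≟ f
  ... | yes refl | _ = sym (begin
    lookup (v ⊕ e ⊕ f) e    ≡⟨ lookup-⊕-other (v ⊕ e) e≢f ⟩
    lookup (v ⊕ e) e        ≡⟨ lookup-⊕-self v e ⟩
    not (lookup v e)        ≡⟨ cong not ve ⟩
    true                    ≡⟨ ue ⟨
    lookup u e              ∎)
  ... | no _ | yes refl = sym (begin
    lookup (v ⊕ e ⊕ f) f    ≡⟨ lookup-⊕-self (v ⊕ e) f ⟩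
    not (lookup (v ⊕ e) f)  ≡⟨ cong not (lookup-⊕-other v (e≢f ∘ sym)) ⟩
    not (lookup v f)        ≡⟨ cong not vf ⟩
    false                   ≡⟨ uf ⟨
    lookup u f              ∎)
  ... | no i≢e | no i≢f = trans (agree i≢e i≢f) (sym (lookup-⊕⊕-other v i≢e i≢f))

AdjU⇒exchange : ∀ {u v : Subset n} → AdjU r n u v →
  ∃₂ λ e f → lookup v e ≡ false × lookup v f ≡ true × u ≡ v ⊕ e ⊕ f
AdjU⇒exchange {u = u} {v} adj
  with ∣p∣≡1⇒singleton (u ─ v) (AdjU⇒∣─∣≡1 {u = u} {v} adj)
     | ∣p∣≡1⇒singleton (v ─ u) (AdjU⇒∣─∣≡1 {u = v} {u} (AdjU-sym {S = u} {v} adj))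
... | e , u─v∋e , e-unique | f , v─u∋f , f-unique =
  e , f , proj₂ (lookup-─⁻ u v u─v∋e) , proj₁ (lookup-─⁻ v u v─u∋f) ,
  differ-exactly-at⇒≡⊕⊕ u v u─v∋e e-unique v─u∋f f-unique

elements : Subset n → List (Fin n)
elements []          = []
elements (true  ∷ p) = zero ∷ List.map suc (elements p)
elements (false ∷ p) = List.map suc (elements p)

length-elements : ∀ (p : Subset n) → length (elements p) ≡ ∣ p ∣
length-elements []          = refl
length-elements (true  ∷ p) = cong suc (trans (length-map suc (elements p)) (length-elements p))
length-elements (false ∷ p) = trans (length-map suc (elements p)) (length-elements p)

elements-unique : ∀ (p : Subset n) → Unique (elements p)
elements-unique []          = []
elements-unique (true  ∷ p) =
  All.map⁺ (All.universal (λ _ ()) (elements p)) ∷ Unique.map⁺ Fin.suc-injective (elements-unique p)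
elements-unique (false ∷ p) = Unique.map⁺ Fin.suc-injective (elements-unique p)

∈-elements⁻ : ∀ (p : Subset n) {i} → i ∈ₗ elements p → lookup p i ≡ true
∈-elements⁻ (true  ∷ p) (here refl) = refl
∈-elements⁻ (true  ∷ p) (there i∈) with ∈-map⁻ suc i∈
... | j , j∈ , refl = ∈-elements⁻ p j∈
∈-elements⁻ (false ∷ p) i∈ with ∈-map⁻ suc i∈
... | j , j∈ , refl = ∈-elements⁻ p j∈

length-cartesianProduct : ∀ {A B : Set} (xs : List A) (ys : List B) →
  length (cartesianProduct xs ys) ≡ length xs * length ys
length-cartesianProduct []       ys = refl
length-cartesianProduct (x ∷ xs) ys = begin
  length (List.map (x ,_) ys ++ cartesianProduct xs ys)
    ≡⟨ length-++ (List.map (x ,_) ys) ⟩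
  length (List.map (x ,_) ys) + length (cartesianProduct xs ys)
    ≡⟨ cong₂ _+_ (length-map (x ,_) ys) (length-cartesianProduct xs ys) ⟩
  length ys + length xs * length ys
    ∎
  where open ≡-Reasoning

Unique-map⁺-on : ∀ {A B : Set} {P : A → Set} (g : A → B) →
  (∀ {x y} → P x → P y → g x ≡ g y → x ≡ y) →
  ∀ {xs} → All P xs → Unique xs → Unique (List.map g xs)
Unique-map⁺-on g injective []         []           = []
Unique-map⁺-on {P = P} g injective (px ∷ pxs) (x∉xs ∷ uxs) =
  separated px pxs x∉xs ∷ Unique-map⁺-on g injective pxs uxs
  where
  separated : ∀ {x ys} → P x → All P ys → All (x ≢_) ys → All (g x ≢_) (List.map g ys)
  separated px []         []           = []
  separated px (py ∷ pys) (x≢y ∷ x≢ys) = (x≢y ∘ injective px py) ∷ separated px pys x≢ys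

module Cycles {n r} (v : Subset n) (e f : Fin n) (ve : lookup v e ≡ false) (vf : lookup v f ≡ true)
              (uv : AdjU r n (v ⊕ e ⊕ f) v) where

  u : Subset n
  u = v ⊕ e ⊕ f

  ∣u∣ : ∣ u ∣ ≡ r
  ∣u∣ = proj₁ uv

  ∣v∣ : ∣ v ∣ ≡ r
  ∣v∣ = proj₁ (proj₂ uv)

  e≢f : e ≢ f
  e≢f = lookup-≢ {S = v} vf ve ∘ sym

  ue : lookup u e ≡ true
  ue = trans (lookup-⊕-other (v ⊕ e) e≢f) (trans (lookup-⊕-self v e) (cong not ve))

  uf : lookup u f ≡ false
  uf = trans (lookup-⊕-self (v ⊕ e) f) (cong not (trans (lookup-⊕-other v (e≢f ∘ sym)) vf))

  e-unique : ∀ e′ → e′ ∈ u → e′ ∉ v → e′ ≡ e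
  e-unique e′ e′∈u e′∉v with e′ ≟ e | e′ ≟ f
  ... | yes e′≡e | _        = e′≡e
  ... | no _     | yes refl = contradiction (lookup⇒[]= f v vf) e′∉v
  ... | no e′≢e  | no e′≢f  =
    contradiction (lookup⇒[]= e′ v (trans (sym (lookup-⊕⊕-other v e′≢e e′≢f)) ([]=⇒lookup e′∈u))) e′∉v

  -- u ∩ v and the complement of u ∪ v
  shared unused : Subset n
  shared = v ⊕ f
  unused = ∁ v ⊕ e

  ∣shared∣ : ∣ shared ∣ ≡ r ∸ 1
  ∣shared∣ = trans (∣⊕∣-remove v f vf) (cong (_∸ 1) ∣v∣)

  ∁v∋e : lookup (∁ v) e ≡ true
  ∁v∋e = trans (lookup-map e not v) (cong not ve)

  ∣unused∣ : ∣ unused ∣ ≡ n ∸ r ∸ 1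
  ∣unused∣ = trans (∣⊕∣-remove (∁ v) e ∁v∋e) (cong (_∸ 1) (trans (∣∁p∣≡n∸∣p∣ v) (cong (n ∸_) ∣v∣)))

  Shared Unused : Fin n → Set
  Shared a = lookup v a ≡ true × a ≢ f
  Unused y = lookup v y ≡ false × y ≢ e

  shared⇒Shared : ∀ {a} → lookup shared a ≡ true → Shared a
  shared⇒Shared h = let a≢f , va = lookup-⊕⁻ v vf h in va , a≢f

  unused⇒Unused : ∀ {y} → lookup unused y ≡ true → Unused y
  unused⇒Unused {y} h =
    let y≢e , ∁vy = lookup-⊕⁻ (∁ v) ∁v∋e h in not-injective (trans (sym (lookup-map y not v)) ∁vy) , y≢e

  u-shared : ∀ {a} → Shared a → lookup u a ≡ true
  u-shared (va , a≢f) = trans (lookup-⊕⊕-other v (lookup-≢ {S = v} va ve) a≢f) va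

  u-unused : ∀ {y} → Unused y → lookup u y ≡ false
  u-unused (vy , y≢e) = trans (lookup-⊕⊕-other v y≢e (lookup-≢ {S = v} vf vy ∘ sym)) vy

  module Square (x z : Fin n) {a y : Fin n} (sa : Shared a) (uy : Unused y)
                (vx : lookup v x ≡ true) (uz : lookup u z ≡ false) where

    B₃ B₄ : Subset n
    B₃ = v ⊕ x ⊕ y
    B₄ = u ⊕ a ⊕ z

    a≢z : a ≢ z
    a≢z = lookup-≢ {S = u} (u-shared sa) uz

    y≢x : y ≢ x
    y≢x = lookup-≢ {S = v} vx (proj₁ uy) ∘ sym

    v~B₃ : AdjU r n v B₃
    v~B₃ = exchange-adjacent v ∣v∣ vx (proj₁ uy)

    B₄~u : AdjU r n B₄ u
    B₄~u = AdjU-sym {S = u} (exchange-adjacent u ∣u∣ (u-shared sa) uz)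

    ∣B₃∣ : ∣ B₃ ∣ ≡ r
    ∣B₃∣ = proj₁ (proj₂ v~B₃)

    B₃e : lookup B₃ e ≡ false
    B₃e = trans (lookup-⊕⊕-other v (lookup-≢ {S = v} vx ve ∘ sym) (proj₂ uy ∘ sym)) ve

    B₄e : lookup B₄ e ≡ true
    B₄e = trans (lookup-⊕⊕-other u (lookup-≢ {S = v} (proj₁ sa) ve ∘ sym) (lookup-≢ {S = u} ue uz)) ue

    B₃y : lookup B₃ y ≡ true
    B₃y = trans (lookup-⊕-self (v ⊕ x) y) (cong not (trans (lookup-⊕-other v y≢x) (proj₁ uy)))

    B₄a : lookup B₄ a ≡ false
    B₄a = trans (lookup-⊕-other (u ⊕ a) a≢z) (trans (lookup-⊕-self u a) (cong not (u-shared sa)))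

    y-unique : ∀ {y′} → lookup v y′ ≡ false → lookup B₃ y′ ≡ true → y′ ≡ y
    y-unique {y′} vy′ B₃y′ = decidable-stable (y′ ≟ y) λ y′≢y →
      contradiction (trans (sym B₃y′) (trans (lookup-⊕⊕-other v (lookup-≢ {S = v} vx vy′ ∘ sym) y′≢y) vy′)) λ ()

    a-unique : ∀ {a′} → Shared a′ → lookup B₄ a′ ≡ false → a′ ≡ a
    a-unique {a′} sa′ B₄a′ = decidable-stable (a′ ≟ a) λ a′≢a →
      contradiction (trans (sym B₄a′) (trans (lookup-⊕⊕-other u a′≢a (lookup-≢ {S = u} (u-shared sa′) uz)) (u-shared sa′))) λ ()

    good : AdjU r n B₃ B₄ → GoodCycleU r n u v B₃ B₄
    good B₃~B₄ = good-cycle uv v~B₃ B₃~B₄ B₄~u ue ve B₃e B₄e e-unique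

  dropped : Fin 3 → Fin n → Fin n
  dropped zero             a = f
  dropped (suc zero)       a = a
  dropped (suc (suc zero)) a = a

  added : Fin 3 → Fin n → Fin n
  added zero             y = y
  added (suc zero)       y = y
  added (suc (suc zero)) y = f

  dropped∈v : ∀ t {a} → Shared a → lookup v (dropped t a) ≡ true
  dropped∈v zero             _  = vf
  dropped∈v (suc zero)       sa = proj₁ sa
  dropped∈v (suc (suc zero)) sa = proj₁ sa

  added∉u : ∀ t {y} → Unused y → lookup u (added t y) ≡ false
  added∉u zero             uy = u-unused uy
  added∉u (suc zero)       uy = u-unused uy
  added∉u (suc (suc zero)) _  = uf

  module Cycle (t : Fin 3) {a y : Fin n} (sa : Shared a) (uy : Unused y) =
    Square (dropped t a) (added t y) sa uy (dropped∈v t sa) (added∉u t uy)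

  B₃~B₄ : ∀ t {a y} (sa : Shared a) (uy : Unused y) → AdjU r n (Cycle.B₃ t sa uy) (Cycle.B₄ t sa uy)
  B₃~B₄ zero {a} {y} sa uy = subst (AdjU r n B₃) toggles (exchange-adjacent B₃ ∣B₃∣ B₃a B₃e)
    where
    open Cycle zero sa uy
    open ≡-Reasoning
    B₃a : lookup B₃ a ≡ true
    B₃a = trans (lookup-⊕⊕-other v (proj₂ sa) (a≢z)) (proj₁ sa)
    toggles : B₃ ⊕ a ⊕ e ≡ B₄
    toggles = begin
      v ⊕ f ⊕ y ⊕ a ⊕ e    ≡⟨ ⊕-comm (v ⊕ f ⊕ y) a e ⟩
      v ⊕ f ⊕ y ⊕ e ⊕ a    ≡⟨ cong (_⊕ a) (⊕-comm (v ⊕ f) y e) ⟩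
      v ⊕ f ⊕ e ⊕ y ⊕ a    ≡⟨ cong (λ S → S ⊕ y ⊕ a) (⊕-comm v f e) ⟩
      v ⊕ e ⊕ f ⊕ y ⊕ a    ≡⟨ ⊕-comm (v ⊕ e ⊕ f) y a ⟩
      v ⊕ e ⊕ f ⊕ a ⊕ y    ∎
  B₃~B₄ (suc zero) {a} {y} sa uy = subst (AdjU r n B₃) toggles (exchange-adjacent B₃ ∣B₃∣ B₃f B₃e)
    where
    open Cycle (suc zero) sa uy
    open ≡-Reasoning
    B₃f : lookup B₃ f ≡ true
    B₃f = trans (lookup-⊕⊕-other v (proj₂ sa ∘ sym) (lookup-≢ {S = v} vf (proj₁ uy))) vf
    toggles : B₃ ⊕ f ⊕ e ≡ B₄
    toggles = begin
      v ⊕ a ⊕ y ⊕ f ⊕ e    ≡⟨ cong (_⊕ e) (⊕-comm (v ⊕ a) y f) ⟩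
      v ⊕ a ⊕ f ⊕ y ⊕ e    ≡⟨ ⊕-comm (v ⊕ a ⊕ f) y e ⟩
      v ⊕ a ⊕ f ⊕ e ⊕ y    ≡⟨ cong (λ S → S ⊕ e ⊕ y) (⊕-comm v a f) ⟩
      v ⊕ f ⊕ a ⊕ e ⊕ y    ≡⟨ cong (_⊕ y) (⊕-comm (v ⊕ f) a e) ⟩
      v ⊕ f ⊕ e ⊕ a ⊕ y    ≡⟨ cong (λ S → S ⊕ a ⊕ y) (⊕-comm v f e) ⟩
      v ⊕ e ⊕ f ⊕ a ⊕ y    ∎
  B₃~B₄ (suc (suc zero)) {a} {y} sa uy = subst (AdjU r n B₃) toggles (exchange-adjacent B₃ ∣B₃∣ B₃y B₃e)
    where
    open Cycle (suc (suc zero)) sa uy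
    open ≡-Reasoning
    toggles : B₃ ⊕ y ⊕ e ≡ B₄
    toggles = begin
      v ⊕ a ⊕ y ⊕ y ⊕ e    ≡⟨ cong (_⊕ e) (⊕-involutive (v ⊕ a) y) ⟩
      v ⊕ a ⊕ e            ≡⟨ ⊕-comm v a e ⟩
      v ⊕ e ⊕ a            ≡⟨ cong (_⊕ a) (⊕-involutive (v ⊕ e) f) ⟨
      v ⊕ e ⊕ f ⊕ f ⊕ a    ≡⟨ ⊕-comm (v ⊕ e ⊕ f) f a ⟩
      v ⊕ e ⊕ f ⊕ a ⊕ f    ∎

  f-profile : Fin 3 → Bool × Bool
  f-profile zero             = false , false
  f-profile (suc zero)       = true  , false
  f-profile (suc (suc zero)) = true  , true

  f-profile-injective : ∀ {t t′} → f-profile t ≡ f-profile t′ → t ≡ t′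
  f-profile-injective {zero}             {zero}             _ = refl
  f-profile-injective {suc zero}         {suc zero}         _ = refl
  f-profile-injective {suc (suc zero)}   {suc (suc zero)}   _ = refl
  f-profile-injective {zero}             {suc zero}         ()
  f-profile-injective {zero}             {suc (suc zero)}   ()
  f-profile-injective {suc zero}         {zero}             ()
  f-profile-injective {suc zero}         {suc (suc zero)}   ()
  f-profile-injective {suc (suc zero)}   {zero}             ()
  f-profile-injective {suc (suc zero)}   {suc zero}         ()

  Candidate : Set
  Candidate = Fin 3 × Fin n × Fin n

  Valid : Candidate → Set
  Valid (t , y , a) = Unused y × Shared a

  cycle : Candidate → Subset n × Subset n
  cycle (t , y , a) = v ⊕ dropped t a ⊕ y , u ⊕ a ⊕ added t y

  f-membership : Subset n × Subset n → Bool × Bool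
  f-membership (B₃ , B₄) = lookup B₃ f , lookup B₄ f

  cycle-f-membership : ∀ t {a y} → Shared a → Unused y → f-membership (cycle (t , y , a)) ≡ f-profile t
  cycle-f-membership t {a} {y} sa uy = cong₂ _,_ (B₃f t) (B₄f t)
    where
    f≢a : f ≢ a
    f≢a = proj₂ sa ∘ sym
    f≢y : f ≢ y
    f≢y = lookup-≢ {S = v} vf (proj₁ uy)
    B₃f : ∀ t → lookup (Cycle.B₃ t sa uy) f ≡ proj₁ (f-profile t)
    B₃f zero             = trans (lookup-⊕-other (v ⊕ f) f≢y) (trans (lookup-⊕-self v f) (cong not vf))
    B₃f (suc zero)       = trans (lookup-⊕⊕-other v f≢a f≢y) vf
    B₃f (suc (suc zero)) = trans (lookup-⊕⊕-other v f≢a f≢y) vf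
    B₄f : ∀ t → lookup (Cycle.B₄ t sa uy) f ≡ proj₂ (f-profile t)
    B₄f zero             = trans (lookup-⊕⊕-other u f≢a f≢y) uf
    B₄f (suc zero)       = trans (lookup-⊕⊕-other u f≢a f≢y) uf
    B₄f (suc (suc zero)) = trans (lookup-⊕-self (u ⊕ a) f) (cong not (trans (lookup-⊕-other u f≢a) uf))

  cycle-good : ∀ {c} → Valid c → GoodCycleU r n u v (proj₁ (cycle c)) (proj₂ (cycle c))
  cycle-good {t , y , a} (uy , sa) = Cycle.good t sa uy (B₃~B₄ t sa uy)

  cycle-injective : ∀ {c c′} → Valid c → Valid c′ → cycle c ≡ cycle c′ → c ≡ c′
  cycle-injective {t , y , a} {t′ , y′ , a′} (uy , sa) (uy′ , sa′) eq
    with f-profile-injective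
           (trans (sym (cycle-f-membership t sa uy)) (trans (cong f-membership eq) (cycle-f-membership t′ sa′ uy′)))
  ... | refl = cong₂ (λ y a → t , y , a) (sym y′≡y) (sym a′≡a)
    where
    module C = Cycle t sa uy
    module C′ = Cycle t sa′ uy′
    y′≡y : y′ ≡ y
    y′≡y = C.y-unique (proj₁ uy′) (trans (cong (λ B → lookup (proj₁ B) y′) eq) C′.B₃y)
    a′≡a : a′ ≡ a
    a′≡a = C.a-unique sa′ (trans (cong (λ B → lookup (proj₂ B) a′) eq) C′.B₄a)

  candidates : List Candidate
  candidates = cartesianProduct (allFin 3) (cartesianProduct (elements unused) (elements shared))

  candidates-unique : Unique candidates
  candidates-unique =
    Unique.cartesianProduct⁺ (Unique.allFin⁺ 3)
      (Unique.cartesianProduct⁺ (elements-unique unused) (elements-unique shared))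

  candidates-valid : All Valid candidates
  candidates-valid = All.tabulate λ {(t , y , a)} c∈ →
    let y∈ , a∈ = ∈-cartesianProduct⁻ (elements unused) (elements shared)
                    (proj₂ (∈-cartesianProduct⁻ (allFin 3) _ c∈))
    in unused⇒Unused (∈-elements⁻ unused y∈) , shared⇒Shared (∈-elements⁻ shared a∈)

  length-candidates : length candidates ≡ 3 * (n ∸ r ∸ 1) * (r ∸ 1)
  length-candidates = begin
    length candidates
      ≡⟨ length-cartesianProduct (allFin 3) (cartesianProduct (elements unused) (elements shared)) ⟩
    3 * length (cartesianProduct (elements unused) (elements shared))
      ≡⟨ cong (3 *_) (length-cartesianProduct (elements unused) (elements shared)) ⟩
    3 * (length (elements unused) * length (elements shared))
      ≡⟨ cong₂ (λ k l → 3 * (k * l))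
               (trans (length-elements unused) ∣unused∣) (trans (length-elements shared) ∣shared∣) ⟩
    3 * ((n ∸ r ∸ 1) * (r ∸ 1))
      ≡⟨ *-assoc 3 (n ∸ r ∸ 1) (r ∸ 1) ⟨
    3 * (n ∸ r ∸ 1) * (r ∸ 1)
      ∎
    where open ≡-Reasoning

proposition3p6 : (n r : ℕ) → 1 ≤ r → r < n →
    (B₁ B₂ : Subset n) → AdjU r n B₁ B₂ →
    Σ (List (Subset n × Subset n)) λ cs →
      Unique cs ×
      All (λ c → GoodCycleU r n B₁ B₂ (proj₁ c) (proj₂ c)) cs ×
      3 * (n ∸ r ∸ 1) * (r ∸ 1) ≤ length cs
proposition3p6 n r _ _ B₁ B₂ adj with AdjU⇒exchange {u = B₁} {B₂} adj
... | e , f , ve , vf , refl =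
  List.map cycle candidates ,
  Unique-map⁺-on cycle cycle-injective candidates-valid candidates-unique ,
  All.map⁺ (All.map cycle-good candidates-valid) ,
  ≤-reflexive (trans (sym length-candidates) (sym (length-map cycle candidates)))
  where open Cycles B₂ e f ve vf adj
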